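{- Let $t$ be a $\lambda\mu$-term and $y$ a $\lambda$-variable. If $(t\,y)$ is normalizable, then $t$ is normalizable.
   Context: $\lambda\mu$-terms over disjoint infinite sets of $\lambda$-variables and $\mu$-variables: $t ::= x \mid \lambda x.t \mid (t\,t) \mid \mu\alpha.t \mid (\alpha\,t)$. $u[\alpha:=^*v]$ replaces inductively each subterm $(\alpha\,w)$ of $u$ by $(\alpha\,(w\,v))$. One-step reduction $\triangleright$ is the compatible closure of $(\lambda x.u\;v)\triangleright u[x:=v]$ and $(\mu\alpha.u\;v)\triangleright\mu\alpha.u[\alpha:=^*v]$. A redex is a subterm of the form $(\lambda x.u\;v)$ or $(\mu\alpha.u\;v)$; a term is normal if it contains no redex; a term is normalizable if some reduction sequence starting from it terminates (reaches a normal term). -}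

module Defs where

open import Data.Nat using (ℕ; zero; suc; pred; _<ᵇ_; _≡ᵇ_)
open import Data.Bool using (Bool; true; false; if_then_else_)
open import Data.Product using (Σ; ∃; _×_; _,_)
open import Relation.Nullary using (¬_)

-- λμ-terms with de Bruijn indices, two separate index spaces:
-- λ-variables (bound by lam) and μ-variables (bound by mu).
data Term : Set where
  var  : ℕ → Term
  lam  : Term → Term
  app  : Term → Term → Term
  mu   : Term → Term
  name : ℕ → Term → Term

shiftλ : ℕ → Term → Term
shiftλ c (var n)    = if n <ᵇ c then var n else var (suc n)
shiftλ c (lam t)    = lam (shiftλ (suc c) t)
shiftλ c (app t u)  = app (shiftλ c t) (shiftλ c u)
shiftλ c (mu t)     = mu (shiftλ c t)
shiftλ c (name a t) = name a (shiftλ c t)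

shiftμ : ℕ → Term → Term
shiftμ c (var n)    = var n
shiftμ c (lam t)    = lam (shiftμ c t)
shiftμ c (app t u)  = app (shiftμ c t) (shiftμ c u)
shiftμ c (mu t)     = mu (shiftμ (suc c) t)
shiftμ c (name a t) = name (if a <ᵇ c then a else suc a) (shiftμ c t)

-- capture-avoiding substitution t[j := s] of a λ-variable, removing the binder
-- (free λ-variables above j are decremented)
subλ : ℕ → Term → Term → Term
subλ j s (var n)    = if n <ᵇ j then var n else (if n ≡ᵇ j then s else var (pred n))
subλ j s (lam t)    = lam (subλ (suc j) (shiftλ 0 s) t)
subλ j s (app t u)  = app (subλ j s t) (subλ j s u)
subλ j s (mu t)     = mu (subλ j (shiftμ 0 s) t)
subλ j s (name a t) = name a (subλ j s t)

subμ : ℕ → Term → Term → Term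
subμ α v (var n)    = var n
subμ α v (lam t)    = lam (subμ α (shiftλ 0 v) t)
subμ α v (app t u)  = app (subμ α v t) (subμ α v u)
subμ α v (mu t)     = mu (subμ (suc α) (shiftμ 0 v) t)
subμ α v (name b t) = if b ≡ᵇ α then name b (app (subμ α v t) v) else name b (subμ α v t)

infix 4 _▷_
data _▷_ : Term → Term → Set where
  βλ   : ∀ {u v} → app (lam u) v ▷ subλ 0 v u
  βμ   : ∀ {u v} → app (mu u) v ▷ mu (subμ 0 (shiftμ 0 v) u)
  ξlam : ∀ {t t'} → t ▷ t' → lam t ▷ lam t'
  ξappl : ∀ {t t' u} → t ▷ t' → app t u ▷ app t' u
  ξappr : ∀ {t u u'} → u ▷ u' → app t u ▷ app t u'
  ξmu  : ∀ {t t'} → t ▷ t' → mu t ▷ mu t'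
  ξname : ∀ {a t t'} → t ▷ t' → name a t ▷ name a t'

infix 4 _▷*_
data _▷*_ : Term → Term → Set where
  refl* : ∀ {t} → t ▷* t
  step* : ∀ {t t' t''} → t ▷ t' → t' ▷* t'' → t ▷* t''

data IsRedex : Term → Set where
  rλ : ∀ {u v} → IsRedex (app (lam u) v)
  rμ : ∀ {u v} → IsRedex (app (mu u) v)

infix 4 _⊑_
data _⊑_ : Term → Term → Set where
  here  : ∀ {t} → t ⊑ t
  inlam : ∀ {s t} → s ⊑ t → s ⊑ lam t
  inappl : ∀ {s t u} → s ⊑ t → s ⊑ app t u
  inappr : ∀ {s t u} → s ⊑ u → s ⊑ app t u
  inmu  : ∀ {s t} → s ⊑ t → s ⊑ mu t
  inname : ∀ {s a t} → s ⊑ t → s ⊑ name a t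

Normal : Term → Set
Normal t = ∀ s → s ⊑ t → ¬ IsRedex s

Normalizable : Term → Set
Normalizable t = ∃ λ n → (t ▷* n) × Normal n

-- A normalizing reduction of (t y) is pulled back, step by step, to a
-- reduction of t.  The invariant is a simulation SimApp ρ u ys w: w is u applied
-- to the λ-variables ys, except that leading arguments may already have been
-- absorbed by λ's of u (a β-step substituting a variable) or pushed into a μ of
-- u (a μ-step; inside the μ every (α v) then carries v applied to them, which is
-- recorded by an environment ρ of pending arguments, relation Sim ρ).  Each step
-- of w is matched by at most one step of u (sim-step) and u is normal when w is
-- (NF-reflect); starting from u = t, ys = [y], w = (t y) this transports a
-- normalizing reduction of (t y) to one of t.

module Submission where

open import Defs
open import Data.Nat using (ℕ; zero; suc; pred; _<ᵇ_; _≡ᵇ_; _<_; _≤_; _<?_; z≤n; s≤s; s<s)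
open import Data.Nat.Properties
open import Data.Bool using (true; false; T; if_then_else_)
open import Data.Bool.Properties using (T-≡)
open import Data.List using (List; []; _∷_; _++_; map)
open import Data.List.Properties using (map-++; map-∘; map-id; map-cong-local; ++-conicalʳ)
open import Data.List.Relation.Unary.All as All using (All; []; _∷_)
open import Data.List.Relation.Unary.All.Properties using (++⁻; map⁺)
open import Data.Product using (Σ; _,_; _×_)
open import Data.Sum using (_⊎_; inj₁; inj₂)
open import Data.Empty using (⊥-elim)
open import Function using (_∘_; id)
open import Function.Bundles using (Equivalence)
open import Relation.Nullary using (¬_; yes; no)
open import Relation.Binary using (tri<; tri≈; tri>)
open import Relation.Binary.PropositionalEquality
open ≡-Reasoning

¬T⇒false : ∀ {b} → ¬ T b → b ≡ false
¬T⇒false {false} _  = refl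
¬T⇒false {true}  ¬t = ⊥-elim (¬t _)

<ᵇ-true : ∀ {m n} → m < n → (m <ᵇ n) ≡ true
<ᵇ-true m<n = Equivalence.to T-≡ (<⇒<ᵇ m<n)

<ᵇ-false : ∀ {m n} → n ≤ m → (m <ᵇ n) ≡ false
<ᵇ-false {m} {n} n≤m = ¬T⇒false (λ t → ≤⇒≯ n≤m (<ᵇ⇒< m n t))

≡ᵇ-refl : ∀ n → (n ≡ᵇ n) ≡ true
≡ᵇ-refl n = Equivalence.to T-≡ (≡⇒≡ᵇ n n refl)

≡ᵇ-false : ∀ {m n} → m ≢ n → (m ≡ᵇ n) ≡ false
≡ᵇ-false {m} {n} m≢n = ¬T⇒false (m≢n ∘ ≡ᵇ⇒≡ m n)

suc-pred-< : ∀ {k n} → k < n → suc (pred n) ≡ n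
suc-pred-< (s≤s _) = refl

-- lift c is the action on indices of shiftλ c (on λ-variables) and of
-- shiftμ c (on the names of (α t)): indices below the cutoff c are kept.
lift : ℕ → ℕ → ℕ
lift c n = if n <ᵇ c then n else suc n

lift-below : ∀ {n c} → n < c → lift c n ≡ n
lift-below n<c rewrite <ᵇ-true n<c = refl

lift-above : ∀ {n c} → c ≤ n → lift c n ≡ suc n
lift-above c≤n rewrite <ᵇ-false c≤n = refl

lift-suc : ∀ c n → lift (suc c) (suc n) ≡ suc (lift c n)
lift-suc c n with n <ᵇ c
... | true  = refl
... | false = refl

n≤lift : ∀ c n → n ≤ lift c n
n≤lift c n with n <ᵇ c
... | true  = ≤-refl
... | false = n≤1+n n

lift≤suc : ∀ c n → lift c n ≤ suc n
lift≤suc c n with n <ᵇ c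
... | true  = n≤1+n n
... | false = ≤-refl

lift-lift : ∀ {c d} → c ≤ d → ∀ n → lift (suc d) (lift c n) ≡ lift c (lift d n)
lift-lift {c} {d} c≤d n with n <? c | n <? d
... | yes n<c | _ = begin
    lift (suc d) (lift c n) ≡⟨ cong (lift (suc d)) (lift-below n<c) ⟩
    lift (suc d) n          ≡⟨ lift-below (m<n⇒m<1+n n<d) ⟩
    n                       ≡⟨ sym (lift-below n<c) ⟩
    lift c n                ≡⟨ cong (lift c) (sym (lift-below n<d)) ⟩
    lift c (lift d n)       ∎
  where n<d = <-≤-trans n<c c≤d
... | no n≮c | yes n<d = begin
    lift (suc d) (lift c n) ≡⟨ cong (lift (suc d)) (lift-above (≮⇒≥ n≮c)) ⟩
    lift (suc d) (suc n)    ≡⟨ lift-below (s<s n<d) ⟩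
    suc n                   ≡⟨ sym (lift-above (≮⇒≥ n≮c)) ⟩
    lift c n                ≡⟨ cong (lift c) (sym (lift-below n<d)) ⟩
    lift c (lift d n)       ∎
... | no n≮c | no n≮d = begin
    lift (suc d) (lift c n) ≡⟨ cong (lift (suc d)) (lift-above (≮⇒≥ n≮c)) ⟩
    lift (suc d) (suc n)    ≡⟨ lift-above (s≤s (≮⇒≥ n≮d)) ⟩
    suc (suc n)             ≡⟨ sym (lift-above (m≤n⇒m≤1+n (≮⇒≥ n≮c))) ⟩
    lift c (suc n)          ≡⟨ cong (lift c) (sym (lift-above (≮⇒≥ n≮d))) ⟩
    lift c (lift d n)       ∎

shiftλ-var : ∀ c n → shiftλ c (var n) ≡ var (lift c n)
shiftλ-var c n with n <ᵇ c
... | true  = refl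
... | false = refl

shiftλ-below : ∀ {n c} → n < c → shiftλ c (var n) ≡ var n
shiftλ-below {n} {c} n<c = trans (shiftλ-var c n) (cong var (lift-below n<c))

shiftλ-above : ∀ {n c} → c ≤ n → shiftλ c (var n) ≡ var (suc n)
shiftλ-above {n} {c} c≤n = trans (shiftλ-var c n) (cong var (lift-above c≤n))

subλ-below : ∀ {n j} s → n < j → subλ j s (var n) ≡ var n
subλ-below s n<j rewrite <ᵇ-true n<j = refl

subλ-at : ∀ j s → subλ j s (var j) ≡ s
subλ-at j s rewrite <ᵇ-false (≤-refl {j}) | ≡ᵇ-refl j = refl

subλ-above : ∀ {n j} s → j < n → subλ j s (var n) ≡ var (pred n)
subλ-above {n} {j} s j<n
  rewrite <ᵇ-false (<⇒≤ j<n) | ≡ᵇ-false {n} {j} (>⇒≢ j<n) = refl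

shiftλ-shiftλ : ∀ {c d} → c ≤ d → ∀ b → shiftλ (suc d) (shiftλ c b) ≡ shiftλ c (shiftλ d b)
shiftλ-shiftλ {c} {d} c≤d (var n) = begin
  shiftλ (suc d) (shiftλ c (var n)) ≡⟨ cong (shiftλ (suc d)) (shiftλ-var c n) ⟩
  shiftλ (suc d) (var (lift c n))   ≡⟨ shiftλ-var (suc d) (lift c n) ⟩
  var (lift (suc d) (lift c n))     ≡⟨ cong var (lift-lift c≤d n) ⟩
  var (lift c (lift d n))           ≡⟨ sym (shiftλ-var c (lift d n)) ⟩
  shiftλ c (var (lift d n))         ≡⟨ cong (shiftλ c) (sym (shiftλ-var d n)) ⟩
  shiftλ c (shiftλ d (var n))       ∎
shiftλ-shiftλ c≤d (lam b)    = cong lam (shiftλ-shiftλ (s≤s c≤d) b)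
shiftλ-shiftλ c≤d (app a b)  = cong₂ app (shiftλ-shiftλ c≤d a) (shiftλ-shiftλ c≤d b)
shiftλ-shiftλ c≤d (mu b)     = cong mu (shiftλ-shiftλ c≤d b)
shiftλ-shiftλ c≤d (name α b) = cong (name α) (shiftλ-shiftλ c≤d b)

shiftμ-shiftμ : ∀ {c d} → c ≤ d → ∀ b → shiftμ (suc d) (shiftμ c b) ≡ shiftμ c (shiftμ d b)
shiftμ-shiftμ c≤d (var n)    = refl
shiftμ-shiftμ c≤d (lam b)    = cong lam (shiftμ-shiftμ c≤d b)
shiftμ-shiftμ c≤d (app a b)  = cong₂ app (shiftμ-shiftμ c≤d a) (shiftμ-shiftμ c≤d b)
shiftμ-shiftμ c≤d (mu b)     = cong mu (shiftμ-shiftμ (s≤s c≤d) b)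
shiftμ-shiftμ c≤d (name α b) = cong₂ name (lift-lift c≤d α) (shiftμ-shiftμ c≤d b)

-- λ-shifts and μ-shifts act on disjoint kinds of variables, so they commute.
shiftμ-shiftλ : ∀ c d b → shiftμ c (shiftλ d b) ≡ shiftλ d (shiftμ c b)
shiftμ-shiftλ c d (var n)    = trans (cong (shiftμ c) (shiftλ-var d n)) (sym (shiftλ-var d n))
shiftμ-shiftλ c d (lam b)    = cong lam (shiftμ-shiftλ c (suc d) b)
shiftμ-shiftλ c d (app a b)  = cong₂ app (shiftμ-shiftλ c d a) (shiftμ-shiftλ c d b)
shiftμ-shiftλ c d (mu b)     = cong mu (shiftμ-shiftλ (suc c) d b)
shiftμ-shiftλ c d (name α b) = cong (name _) (shiftμ-shiftλ c d b)

subλ-shiftλ : ∀ i s b → subλ i s (shiftλ i b) ≡ b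
subλ-shiftλ i s (var n) with n <? i
... | yes n<i = trans (cong (subλ i s) (shiftλ-below n<i)) (subλ-below s n<i)
... | no  n≮i = trans (cong (subλ i s) (shiftλ-above (≮⇒≥ n≮i))) (subλ-above s (s≤s (≮⇒≥ n≮i)))
subλ-shiftλ i s (lam b)    = cong lam (subλ-shiftλ (suc i) (shiftλ 0 s) b)
subλ-shiftλ i s (app a b)  = cong₂ app (subλ-shiftλ i s a) (subλ-shiftλ i s b)
subλ-shiftλ i s (mu b)     = cong mu (subλ-shiftλ i (shiftμ 0 s) b)
subλ-shiftλ i s (name α b) = cong (name α) (subλ-shiftλ i s b)

shiftμ-subλ : ∀ c j s a → shiftμ c (subλ j s a) ≡ subλ j (shiftμ c s) (shiftμ c a)
shiftμ-subλ c j s (var n) with <-cmp n j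
... | tri< n<j _ _  = trans (cong (shiftμ c) (subλ-below s n<j)) (sym (subλ-below _ n<j))
... | tri≈ _ refl _ = trans (cong (shiftμ c) (subλ-at n s)) (sym (subλ-at n _))
... | tri> _ _ j<n  = trans (cong (shiftμ c) (subλ-above s j<n)) (sym (subλ-above _ j<n))
shiftμ-subλ c j s (lam a) = cong lam (begin
  shiftμ c (subλ (suc j) (shiftλ 0 s) a)
    ≡⟨ shiftμ-subλ c (suc j) (shiftλ 0 s) a ⟩
  subλ (suc j) (shiftμ c (shiftλ 0 s)) (shiftμ c a)
    ≡⟨ cong (λ z → subλ (suc j) z (shiftμ c a)) (shiftμ-shiftλ c 0 s) ⟩
  subλ (suc j) (shiftλ 0 (shiftμ c s)) (shiftμ c a) ∎)
shiftμ-subλ c j s (app a b) = cong₂ app (shiftμ-subλ c j s a) (shiftμ-subλ c j s b)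
shiftμ-subλ c j s (mu a) = cong mu (begin
  shiftμ (suc c) (subλ j (shiftμ 0 s) a)
    ≡⟨ shiftμ-subλ (suc c) j (shiftμ 0 s) a ⟩
  subλ j (shiftμ (suc c) (shiftμ 0 s)) (shiftμ (suc c) a)
    ≡⟨ cong (λ z → subλ j z (shiftμ (suc c) a)) (shiftμ-shiftμ z≤n s) ⟩
  subλ j (shiftμ 0 (shiftμ c s)) (shiftμ (suc c) a) ∎)
shiftμ-subλ c j s (name α a) = cong (name _) (shiftμ-subλ c j s a)

shiftλ-subλ-below : ∀ {c k} → c ≤ k → ∀ b s →
  shiftλ c (subλ k b s) ≡ subλ (suc k) (shiftλ c b) (shiftλ c s)
shiftλ-subλ-below {c} {k} c≤k b (var n) with <-cmp n k
... | tri< n<k _ _ = begin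
  shiftλ c (subλ k b (var n))                  ≡⟨ cong (shiftλ c) (subλ-below b n<k) ⟩
  shiftλ c (var n)                             ≡⟨ shiftλ-var c n ⟩
  var (lift c n)                               ≡⟨ sym (subλ-below _ (s≤s (≤-trans (lift≤suc c n) n<k))) ⟩
  subλ (suc k) (shiftλ c b) (var (lift c n))   ≡⟨ cong (subλ (suc k) _) (sym (shiftλ-var c n)) ⟩
  subλ (suc k) (shiftλ c b) (shiftλ c (var n)) ∎
... | tri≈ _ refl _ = begin
  shiftλ c (subλ n b (var n))                  ≡⟨ cong (shiftλ c) (subλ-at n b) ⟩
  shiftλ c b                                   ≡⟨ sym (subλ-at (suc n) _) ⟩
  subλ (suc n) (shiftλ c b) (var (suc n))      ≡⟨ cong (subλ (suc n) _) (sym (shiftλ-above c≤k)) ⟩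
  subλ (suc n) (shiftλ c b) (shiftλ c (var n)) ∎
... | tri> _ _ k<n = begin
  shiftλ c (subλ k b (var n))                  ≡⟨ cong (shiftλ c) (subλ-above b k<n) ⟩
  shiftλ c (var (pred n))                      ≡⟨ shiftλ-above (≤-trans c≤k (<⇒≤pred k<n)) ⟩
  var (suc (pred n))                           ≡⟨ cong var (suc-pred-< k<n) ⟩
  var n                                        ≡⟨ sym (subλ-above _ (s≤s k<n)) ⟩
  subλ (suc k) (shiftλ c b) (var (suc n))      ≡⟨ cong (subλ (suc k) _) (sym (shiftλ-above (≤-trans c≤k (<⇒≤ k<n)))) ⟩
  subλ (suc k) (shiftλ c b) (shiftλ c (var n)) ∎
shiftλ-subλ-below {c} {k} c≤k b (lam s) = cong lam (begin
  shiftλ (suc c) (subλ (suc k) (shiftλ 0 b) s)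
    ≡⟨ shiftλ-subλ-below (s≤s c≤k) (shiftλ 0 b) s ⟩
  subλ (suc (suc k)) (shiftλ (suc c) (shiftλ 0 b)) (shiftλ (suc c) s)
    ≡⟨ cong (λ z → subλ (suc (suc k)) z (shiftλ (suc c) s)) (shiftλ-shiftλ z≤n b) ⟩
  subλ (suc (suc k)) (shiftλ 0 (shiftλ c b)) (shiftλ (suc c) s) ∎)
shiftλ-subλ-below c≤k b (app s t) = cong₂ app (shiftλ-subλ-below c≤k b s) (shiftλ-subλ-below c≤k b t)
shiftλ-subλ-below {c} {k} c≤k b (mu s) = cong mu (begin
  shiftλ c (subλ k (shiftμ 0 b) s)
    ≡⟨ shiftλ-subλ-below c≤k (shiftμ 0 b) s ⟩
  subλ (suc k) (shiftλ c (shiftμ 0 b)) (shiftλ c s)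
    ≡⟨ cong (λ z → subλ (suc k) z (shiftλ c s)) (sym (shiftμ-shiftλ 0 c b)) ⟩
  subλ (suc k) (shiftμ 0 (shiftλ c b)) (shiftλ c s) ∎)
shiftλ-subλ-below c≤k b (name α s) = cong (name α) (shiftλ-subλ-below c≤k b s)

shiftλ-subλ-above : ∀ {k c} → k ≤ c → ∀ b s →
  shiftλ c (subλ k b s) ≡ subλ k (shiftλ c b) (shiftλ (suc c) s)
shiftλ-subλ-above {k} {c} k≤c b (var n) with <-cmp n k
... | tri< n<k _ _ = begin
  shiftλ c (subλ k b (var n))              ≡⟨ cong (shiftλ c) (subλ-below b n<k) ⟩
  shiftλ c (var n)                         ≡⟨ shiftλ-below (<-≤-trans n<k k≤c) ⟩
  var n                                    ≡⟨ sym (subλ-below _ n<k) ⟩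
  subλ k (shiftλ c b) (var n)              ≡⟨ cong (subλ k _) (sym (shiftλ-below (m<n⇒m<1+n (<-≤-trans n<k k≤c)))) ⟩
  subλ k (shiftλ c b) (shiftλ (suc c) (var n)) ∎
... | tri≈ _ refl _ = begin
  shiftλ c (subλ n b (var n))              ≡⟨ cong (shiftλ c) (subλ-at n b) ⟩
  shiftλ c b                               ≡⟨ sym (subλ-at n _) ⟩
  subλ n (shiftλ c b) (var n)              ≡⟨ cong (subλ n _) (sym (shiftλ-below (s≤s k≤c))) ⟩
  subλ n (shiftλ c b) (shiftλ (suc c) (var n)) ∎
... | tri> _ _ k<n = begin
  shiftλ c (subλ k b (var n))              ≡⟨ cong (shiftλ c) (subλ-above b k<n) ⟩
  shiftλ c (var (pred n))                  ≡⟨ shiftλ-var c (pred n) ⟩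
  var (lift c (pred n))                    ≡⟨ cong var (lift-pred c n k<n) ⟩
  var (pred (lift (suc c) n))              ≡⟨ sym (subλ-above _ (<-≤-trans k<n (n≤lift (suc c) n))) ⟩
  subλ k (shiftλ c b) (var (lift (suc c) n)) ≡⟨ cong (subλ k _) (sym (shiftλ-var (suc c) n)) ⟩
  subλ k (shiftλ c b) (shiftλ (suc c) (var n)) ∎
  where
  lift-pred : ∀ c n → k < n → lift c (pred n) ≡ pred (lift (suc c) n)
  lift-pred c (suc m) _ = sym (cong pred (lift-suc c m))
shiftλ-subλ-above {k} {c} k≤c b (lam s) = cong lam (begin
  shiftλ (suc c) (subλ (suc k) (shiftλ 0 b) s)
    ≡⟨ shiftλ-subλ-above (s≤s k≤c) (shiftλ 0 b) s ⟩
  subλ (suc k) (shiftλ (suc c) (shiftλ 0 b)) (shiftλ (suc (suc c)) s)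
    ≡⟨ cong (λ z → subλ (suc k) z (shiftλ (suc (suc c)) s)) (shiftλ-shiftλ z≤n b) ⟩
  subλ (suc k) (shiftλ 0 (shiftλ c b)) (shiftλ (suc (suc c)) s) ∎)
shiftλ-subλ-above k≤c b (app s t) = cong₂ app (shiftλ-subλ-above k≤c b s) (shiftλ-subλ-above k≤c b t)
shiftλ-subλ-above {k} {c} k≤c b (mu s) = cong mu (begin
  shiftλ c (subλ k (shiftμ 0 b) s)
    ≡⟨ shiftλ-subλ-above k≤c (shiftμ 0 b) s ⟩
  subλ k (shiftλ c (shiftμ 0 b)) (shiftλ (suc c) s)
    ≡⟨ cong (λ z → subλ k z (shiftλ (suc c) s)) (sym (shiftμ-shiftλ 0 c b)) ⟩
  subλ k (shiftμ 0 (shiftλ c b)) (shiftλ (suc c) s) ∎)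
shiftλ-subλ-above k≤c b (name α s) = cong (name α) (shiftλ-subλ-above k≤c b s)

subλ-subλ-var : ∀ {i k} → i ≤ k → ∀ b s n →
  subλ k b (subλ i s (var n)) ≡ subλ i (subλ k b s) (subλ (suc k) (shiftλ i b) (var n))
subλ-subλ-var {i} {k} i≤k b s n with <-cmp n i
... | tri< n<i _ _ = begin
  subλ k b (subλ i s (var n))   ≡⟨ cong (subλ k b) (subλ-below s n<i) ⟩
  subλ k b (var n)              ≡⟨ subλ-below b (<-≤-trans n<i i≤k) ⟩
  var n                         ≡⟨ sym (subλ-below _ n<i) ⟩
  subλ i (subλ k b s) (var n)   ≡⟨ cong (subλ i _) (sym (subλ-below _ (m<n⇒m<1+n (<-≤-trans n<i i≤k)))) ⟩
  subλ i (subλ k b s) (subλ (suc k) (shiftλ i b) (var n)) ∎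
... | tri≈ _ refl _ = begin
  subλ k b (subλ n s (var n))   ≡⟨ cong (subλ k b) (subλ-at n s) ⟩
  subλ k b s                    ≡⟨ sym (subλ-at n _) ⟩
  subλ n (subλ k b s) (var n)   ≡⟨ cong (subλ n _) (sym (subλ-below _ (s≤s i≤k))) ⟩
  subλ n (subλ k b s) (subλ (suc k) (shiftλ n b) (var n)) ∎
... | tri> _ _ i<n with <-cmp n (suc k)
...   | tri< n<1+k _ _ = begin
  subλ k b (subλ i s (var n))   ≡⟨ cong (subλ k b) (subλ-above s i<n) ⟩
  subλ k b (var (pred n))       ≡⟨ subλ-below b (≤-trans (≤-reflexive (suc-pred-< i<n)) (≤-pred n<1+k)) ⟩
  var (pred n)                  ≡⟨ sym (subλ-above _ i<n) ⟩
  subλ i (subλ k b s) (var n)   ≡⟨ cong (subλ i _) (sym (subλ-below _ n<1+k)) ⟩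
  subλ i (subλ k b s) (subλ (suc k) (shiftλ i b) (var n)) ∎
...   | tri≈ _ refl _ = begin
  subλ k b (subλ i s (var (suc k)))   ≡⟨ cong (subλ k b) (subλ-above s i<n) ⟩
  subλ k b (var k)                    ≡⟨ subλ-at k b ⟩
  b                                   ≡⟨ sym (subλ-shiftλ i (subλ k b s) b) ⟩
  subλ i (subλ k b s) (shiftλ i b)    ≡⟨ cong (subλ i _) (sym (subλ-at (suc k) _)) ⟩
  subλ i (subλ k b s) (subλ (suc k) (shiftλ i b) (var (suc k))) ∎
...   | tri> _ _ 1+k<n = begin
  subλ k b (subλ i s (var n))         ≡⟨ cong (subλ k b) (subλ-above s i<n) ⟩
  subλ k b (var (pred n))             ≡⟨ subλ-above b (<⇒≤pred 1+k<n) ⟩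
  var (pred (pred n))                 ≡⟨ sym (subλ-above _ (<-≤-trans (s≤s i≤k) (<⇒≤pred 1+k<n))) ⟩
  subλ i (subλ k b s) (var (pred n))  ≡⟨ cong (subλ i _) (sym (subλ-above _ 1+k<n)) ⟩
  subλ i (subλ k b s) (subλ (suc k) (shiftλ i b) (var n)) ∎

subλ-subλ : ∀ {i k} → i ≤ k → ∀ b s c →
  subλ k b (subλ i s c) ≡ subλ i (subλ k b s) (subλ (suc k) (shiftλ i b) c)
subλ-subλ i≤k b s (var n) = subλ-subλ-var i≤k b s n
subλ-subλ {i} {k} i≤k b s (lam c) = cong lam (begin
  subλ (suc k) (shiftλ 0 b) (subλ (suc i) (shiftλ 0 s) c)
    ≡⟨ subλ-subλ (s≤s i≤k) (shiftλ 0 b) (shiftλ 0 s) c ⟩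
  subλ (suc i) (subλ (suc k) (shiftλ 0 b) (shiftλ 0 s)) (subλ (suc (suc k)) (shiftλ (suc i) (shiftλ 0 b)) c)
    ≡⟨ cong₂ (λ z w → subλ (suc i) z (subλ (suc (suc k)) w c))
             (sym (shiftλ-subλ-below z≤n b s)) (shiftλ-shiftλ z≤n b) ⟩
  subλ (suc i) (shiftλ 0 (subλ k b s)) (subλ (suc (suc k)) (shiftλ 0 (shiftλ i b)) c) ∎)
subλ-subλ i≤k b s (app c d) = cong₂ app (subλ-subλ i≤k b s c) (subλ-subλ i≤k b s d)
subλ-subλ {i} {k} i≤k b s (mu c) = cong mu (begin
  subλ k (shiftμ 0 b) (subλ i (shiftμ 0 s) c)
    ≡⟨ subλ-subλ i≤k (shiftμ 0 b) (shiftμ 0 s) c ⟩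
  subλ i (subλ k (shiftμ 0 b) (shiftμ 0 s)) (subλ (suc k) (shiftλ i (shiftμ 0 b)) c)
    ≡⟨ cong₂ (λ z w → subλ i z (subλ (suc k) w c))
             (sym (shiftμ-subλ 0 k b s)) (sym (shiftμ-shiftλ 0 i b)) ⟩
  subλ i (shiftμ 0 (subλ k b s)) (subλ (suc k) (shiftμ 0 (shiftλ i b)) c) ∎)
subλ-subλ i≤k b s (name α c) = cong (name α) (subλ-subλ i≤k b s c)

rename-var : ∀ j y n → Σ ℕ λ m → subλ j (var y) (var n) ≡ var m
rename-var j y n with n <ᵇ j | n ≡ᵇ j
... | true  | _     = n , refl
... | false | true  = y , refl
... | false | false = pred n , refl

-- Renaming a λ-variable commutes with a structural substitution, since it
-- changes neither names nor the shape of the term.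
rename-subμ : ∀ j y α v a →
  subλ j (var y) (subμ α v a) ≡ subμ α (subλ j (var y) v) (subλ j (var y) a)
rename-subμ j y α v (var n) with rename-var j y n
... | m , eq = trans eq (cong (subμ α _) (sym eq))
rename-subμ j y α v (lam a) = cong lam (begin
  subλ (suc j) (var (suc y)) (subμ α (shiftλ 0 v) a)
    ≡⟨ rename-subμ (suc j) (suc y) α (shiftλ 0 v) a ⟩
  subμ α (subλ (suc j) (var (suc y)) (shiftλ 0 v)) (subλ (suc j) (var (suc y)) a)
    ≡⟨ cong (λ z → subμ α z (subλ (suc j) (var (suc y)) a)) (sym (shiftλ-subλ-below z≤n (var y) v)) ⟩
  subμ α (shiftλ 0 (subλ j (var y) v)) (subλ (suc j) (var (suc y)) a) ∎)
rename-subμ j y α v (app a b) = cong₂ app (rename-subμ j y α v a) (rename-subμ j y α v b)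
rename-subμ j y α v (mu a) = cong mu (begin
  subλ j (var y) (subμ (suc α) (shiftμ 0 v) a)
    ≡⟨ rename-subμ j y (suc α) (shiftμ 0 v) a ⟩
  subμ (suc α) (subλ j (var y) (shiftμ 0 v)) (subλ j (var y) a)
    ≡⟨ cong (λ z → subμ (suc α) z (subλ j (var y) a)) (sym (shiftμ-subλ 0 j (var y) v)) ⟩
  subμ (suc α) (shiftμ 0 (subλ j (var y) v)) (subλ j (var y) a) ∎)
rename-subμ j y α v (name β a) with β ≡ᵇ α
... | true  = cong (name β) (cong₂ app (rename-subμ j y α v a) refl)
... | false = cong (name β) (rename-subμ j y α v a)

-- Terms that create no redex when applied: anything but a λ or a μ.
data Inert : Term → Set where
  inert-var  : ∀ {n} → Inert (var n)
  inert-app  : ∀ {a b} → Inert (app a b)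
  inert-name : ∀ {α a} → Inert (name α a)

data NF : Term → Set where
  nf-var  : ∀ {n} → NF (var n)
  nf-lam  : ∀ {t} → NF t → NF (lam t)
  nf-mu   : ∀ {t} → NF t → NF (mu t)
  nf-name : ∀ {α t} → NF t → NF (name α t)
  nf-app  : ∀ {a b} → Inert a → NF a → NF b → NF (app a b)

Normal⇒NF : ∀ t → Normal t → NF t
Normal⇒NF (var n)    N = nf-var
Normal⇒NF (lam t)    N = nf-lam (Normal⇒NF t (λ s s⊑t → N s (inlam s⊑t)))
Normal⇒NF (mu t)     N = nf-mu (Normal⇒NF t (λ s s⊑t → N s (inmu s⊑t)))
Normal⇒NF (name α t) N = nf-name (Normal⇒NF t (λ s s⊑t → N s (inname s⊑t)))
Normal⇒NF (app a b)  N =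
  nf-app (inert-head a N) (Normal⇒NF a (λ s s⊑a → N s (inappl s⊑a)))
                          (Normal⇒NF b (λ s s⊑b → N s (inappr s⊑b)))
  where
  inert-head : ∀ a {b} → Normal (app a b) → Inert a
  inert-head (var n)    N = inert-var
  inert-head (app a a') N = inert-app
  inert-head (name α a) N = inert-name
  inert-head (lam a)    N = ⊥-elim (N _ here rλ)
  inert-head (mu a)     N = ⊥-elim (N _ here rμ)

NF⇒Normal : ∀ {t} → NF t → Normal t
NF⇒Normal (nf-app () _ _) _ here rλ
NF⇒Normal (nf-app () _ _) _ here rμ
NF⇒Normal (nf-lam n)      s (inlam s⊑t)  r = NF⇒Normal n s s⊑t r
NF⇒Normal (nf-app _ n _)  s (inappl s⊑t) r = NF⇒Normal n s s⊑t r
NF⇒Normal (nf-app _ _ n)  s (inappr s⊑t) r = NF⇒Normal n s s⊑t r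
NF⇒Normal (nf-mu n)       s (inmu s⊑t)   r = NF⇒Normal n s s⊑t r
NF⇒Normal (nf-name n)     s (inname s⊑t) r = NF⇒Normal n s s⊑t r

NF-unrename : ∀ j y c → NF (subλ j (var y) c) → NF c
NF-unrename j y (var n)    _               = nf-var
NF-unrename j y (lam c)    (nf-lam n)      = nf-lam (NF-unrename (suc j) (suc y) c n)
NF-unrename j y (mu c)     (nf-mu n)       = nf-mu (NF-unrename j y c n)
NF-unrename j y (name α c) (nf-name n)     = nf-name (NF-unrename j y c n)
NF-unrename j y (app c d)  (nf-app i n m)  = nf-app (inert-unrename c i) (NF-unrename j y c n) (NF-unrename j y d m)
  where
  inert-unrename : ∀ c → Inert (subλ j (var y) c) → Inert c
  inert-unrename (var n)    _ = inert-var
  inert-unrename (app c d)  _ = inert-app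
  inert-unrename (name α c) _ = inert-name

var-irreducible : ∀ {n t} → ¬ (var n ▷ t)
var-irreducible ()

unrename-step : ∀ j y c {d} → subλ j (var y) c ▷ d →
  Σ Term λ c' → c ▷ c' × d ≡ subλ j (var y) c'
unrename-step j y (var n) step with rename-var j y n
... | m , eq = ⊥-elim (var-irreducible (subst (_▷ _) eq step))
unrename-step j y (lam c) (ξlam step) with unrename-step (suc j) (suc y) c step
... | c' , step' , refl = lam c' , ξlam step' , refl
unrename-step j y (mu c) (ξmu step) with unrename-step j y c step
... | c' , step' , refl = mu c' , ξmu step' , refl
unrename-step j y (name α c) (ξname step) with unrename-step j y c step
... | c' , step' , refl = name α c' , ξname step' , refl
unrename-step j y (app (var n) c₂) step with rename-var j y n
... | m , eq with subst (λ h → app h _ ▷ _) eq step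
...   | ξappl q = ⊥-elim (var-irreducible q)
...   | ξappr q with unrename-step j y c₂ q
...     | c₂' , q' , refl = app (var n) c₂' , ξappr q' , cong (λ h → app h _) (sym eq)
unrename-step j y (app (lam c₁) c₂) βλ =
  subλ 0 c₂ c₁ , βλ , sym (subλ-subλ z≤n (var y) c₂ c₁)
unrename-step j y (app (mu c₁) c₂) βμ =
  mu (subμ 0 (shiftμ 0 c₂) c₁) , βμ ,
  cong mu (trans (cong (λ z → subμ 0 z (subλ j (var y) c₁)) (shiftμ-subλ 0 j (var y) c₂))
                 (sym (rename-subμ j y 0 (shiftμ 0 c₂) c₁)))
unrename-step j y (app c₁ c₂) (ξappl step) with unrename-step j y c₁ step
... | c₁' , step' , refl = app c₁' c₂ , ξappl step' , refl
unrename-step j y (app c₁ c₂) (ξappr step) with unrename-step j y c₂ step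
... | c₂' , step' , refl = app c₁ c₂' , ξappr step' , refl

-- Pending arguments: for each μ-variable α, the list of λ-variables that every
-- occurrence (α w) still has to be applied to.
Env : Set
Env = ℕ → List ℕ

mapₑ : (ℕ → ℕ) → Env → Env
mapₑ f ρ α = map f (ρ α)

underλ : Env → Env
underλ = mapₑ suc

bindμ : List ℕ → Env → Env
bindμ ys ρ zero    = ys
bindμ ys ρ (suc α) = ρ α

bindμ-cong : ∀ ys {ρ ρ'} → ρ ≗ ρ' → bindμ ys ρ ≗ bindμ ys ρ'
bindμ-cong ys ρ≗ρ' zero    = refl
bindμ-cong ys ρ≗ρ' (suc α) = ρ≗ρ' α

mapₑ-bindμ : ∀ f ys ρ → mapₑ f (bindμ ys ρ) ≗ bindμ (map f ys) (mapₑ f ρ)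
mapₑ-bindμ f ys ρ zero    = refl
mapₑ-bindμ f ys ρ (suc α) = refl

map-square : ∀ {f g f' g' : ℕ → ℕ} {xs} → All (λ x → g (f x) ≡ f' (g' x)) xs →
  map g (map f xs) ≡ map f' (map g' xs)
map-square {xs = xs} sq = trans (sym (map-∘ xs)) (trans (map-cong-local sq) (map-∘ xs))

-- Sim ρ u w : w is u in which, under every (α ·), the pending
-- arguments ρ α have been supplied.  SimApp ρ u ys w : w is u applied to the
-- variables ys, where leading arguments may already have been absorbed by λ's
-- of u, or pushed, as a structural substitution, into a μ of u.
data Sim : Env → Term → Term → Set
data SimApp : Env → Term → List ℕ → Term → Set

data Sim where
  sim-var  : ∀ {ρ n} → Sim ρ (var n) (var n)
  sim-lam  : ∀ {ρ a w} → Sim (underλ ρ) a w → Sim ρ (lam a) (lam w)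
  sim-app  : ∀ {ρ a b wa wb} → Sim ρ a wa → Sim ρ b wb → Sim ρ (app a b) (app wa wb)
  sim-mu   : ∀ {ρ a w} → Sim (bindμ [] ρ) a w → Sim ρ (mu a) (mu w)
  sim-name : ∀ {ρ α a w} → SimApp ρ a (ρ α) w → Sim ρ (name α a) (name α w)

data SimApp where
  done     : ∀ {ρ u w} → Sim ρ u w → SimApp ρ u [] w
  applied  : ∀ {ρ u ys ys' y w} → ys' ≡ ys ++ y ∷ [] → SimApp ρ u ys w →
             SimApp ρ u ys' (app w (var y))
  absorbed : ∀ {ρ c y ys w} → SimApp ρ (subλ 0 (var y) c) ys w → SimApp ρ (lam c) (y ∷ ys) w
  pushed   : ∀ {ρ c ys w} → Sim (bindμ ys ρ) c w → SimApp ρ (mu c) ys (mu w)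

sim-cong : ∀ {ρ ρ' u w} → ρ ≗ ρ' → Sim ρ u w → Sim ρ' u w
simApp-cong : ∀ {ρ ρ' u ys w} → ρ ≗ ρ' → SimApp ρ u ys w → SimApp ρ' u ys w
sim-cong ρ≗ρ' sim-var       = sim-var
sim-cong ρ≗ρ' (sim-lam s)   = sim-lam (sim-cong (cong (map suc) ∘ ρ≗ρ') s)
sim-cong ρ≗ρ' (sim-app s t) = sim-app (sim-cong ρ≗ρ' s) (sim-cong ρ≗ρ' t)
sim-cong ρ≗ρ' (sim-mu s)    = sim-mu (sim-cong (bindμ-cong [] ρ≗ρ') s)
sim-cong {ρ' = ρ'} ρ≗ρ' (sim-name {α = α} x) =
  sim-name (subst (λ zs → SimApp ρ' _ zs _) (ρ≗ρ' α) (simApp-cong ρ≗ρ' x))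
simApp-cong ρ≗ρ' (done s)       = done (sim-cong ρ≗ρ' s)
simApp-cong ρ≗ρ' (applied eq x) = applied eq (simApp-cong ρ≗ρ' x)
simApp-cong ρ≗ρ' (absorbed x)   = absorbed (simApp-cong ρ≗ρ' x)
simApp-cong ρ≗ρ' (pushed {ys = ys} s) = pushed (sim-cong (bindμ-cong ys ρ≗ρ') s)

simApp-[] : ∀ {ρ u w} → SimApp ρ u [] w → Sim ρ u w
simApp-[] (done s) = s
simApp-[] (applied {ys = ys} eq _) with ++-conicalʳ ys _ (sym eq)
... | ()
simApp-[] (pushed s) = sim-mu s

inert-reflect : ∀ {ρ a w} → Sim ρ a w → Inert w → Inert a
inert-reflect sim-var       _ = inert-var
inert-reflect (sim-app _ _) _ = inert-app
inert-reflect (sim-name _)  _ = inert-name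

NF-reflect : ∀ {ρ u w} → Sim ρ u w → NF w → NF u
NF-reflectApp : ∀ {ρ u ys w} → SimApp ρ u ys w → NF w → NF u
NF-reflect sim-var       n                = nf-var
NF-reflect (sim-lam s)   (nf-lam n)       = nf-lam (NF-reflect s n)
NF-reflect (sim-app s t) (nf-app i n m)   = nf-app (inert-reflect s i) (NF-reflect s n) (NF-reflect t m)
NF-reflect (sim-mu s)    (nf-mu n)        = nf-mu (NF-reflect s n)
NF-reflect (sim-name x)  (nf-name n)      = nf-name (NF-reflectApp x n)
NF-reflectApp (done s)      n                = NF-reflect s n
NF-reflectApp (applied _ x) (nf-app _ n _)   = NF-reflectApp x n
NF-reflectApp (absorbed {c = c} {y = y} x) n = nf-lam (NF-unrename 0 y c (NF-reflectApp x n))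
NF-reflectApp (pushed s)    (nf-mu n)        = nf-mu (NF-reflect s n)

record Appended (β y : ℕ) (ρ ρ' : Env) : Set where
  field
    elsewhere : ∀ α → α ≢ β → ρ α ≡ ρ' α
    at        : ρ' β ≡ ρ β ++ y ∷ []
open Appended

appended-underλ : ∀ {β y ρ ρ'} → Appended β y ρ ρ' → Appended β (suc y) (underλ ρ) (underλ ρ')
appended-underλ {β} {y} {ρ} ap .elsewhere α α≢β = cong (map suc) (elsewhere ap α α≢β)
appended-underλ {β} {y} {ρ} ap .at = trans (cong (map suc) (at ap)) (map-++ suc (ρ β) (y ∷ []))

appended-bindμ : ∀ {β y ρ ρ'} zs → Appended β y ρ ρ' → Appended (suc β) y (bindμ zs ρ) (bindμ zs ρ')
appended-bindμ zs ap .elsewhere zero    _   = refl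
appended-bindμ zs ap .elsewhere (suc α) α≢β = elsewhere ap α (α≢β ∘ cong suc)
appended-bindμ zs ap .at = at ap

appended-head : ∀ {ys ys' y ρ} → ys' ≡ ys ++ y ∷ [] → Appended 0 y (bindμ ys ρ) (bindμ ys' ρ)
appended-head eq .elsewhere zero    0≢0 = ⊥-elim (0≢0 refl)
appended-head eq .elsewhere (suc α) _   = refl
appended-head eq .at = eq

-- A structural substitution (β w) ↦ (β (w y)) in the simulating term is
-- accounted for by appending y to the pending arguments of β.
sim-subμ-var : ∀ {ρ ρ' β y u w} → Appended β y ρ ρ' → Sim ρ u w → Sim ρ' u (subμ β (var y) w)
simApp-subμ-var : ∀ {ρ ρ' β y u ys w} → Appended β y ρ ρ' → SimApp ρ u ys w →
  SimApp ρ' u ys (subμ β (var y) w)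
sim-subμ-var ap sim-var       = sim-var
sim-subμ-var ap (sim-lam s)   = sim-lam (sim-subμ-var (appended-underλ ap) s)
sim-subμ-var ap (sim-app s t) = sim-app (sim-subμ-var ap s) (sim-subμ-var ap t)
sim-subμ-var ap (sim-mu s)    = sim-mu (sim-subμ-var (appended-bindμ [] ap) s)
sim-subμ-var {ρ' = ρ'} {β} ap (sim-name {α = α} x) with α ≟ β
... | yes refl rewrite ≡ᵇ-refl α = sim-name (applied (at ap) (simApp-subμ-var ap x))
... | no α≢β rewrite ≡ᵇ-false α≢β =
  sim-name (subst (λ zs → SimApp ρ' _ zs _) (elsewhere ap α α≢β) (simApp-subμ-var ap x))
simApp-subμ-var ap (done s)       = done (sim-subμ-var ap s)
simApp-subμ-var ap (applied eq x) = applied eq (simApp-subμ-var ap x)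
simApp-subμ-var ap (absorbed x)   = absorbed (simApp-subμ-var ap x)
simApp-subμ-var ap (pushed {ys = ys} s) = pushed (sim-subμ-var (appended-bindμ ys ap) s)

bindμ-lift : ∀ {ρ ρ' c} zs → (∀ α → ρ' (lift c α) ≡ ρ α) →
  ∀ α → bindμ zs ρ' (lift (suc c) α) ≡ bindμ zs ρ α
bindμ-lift zs h zero = refl
bindμ-lift {ρ' = ρ'} {c} zs h (suc α) = trans (cong (bindμ zs ρ') (lift-suc c α)) (h α)

sim-shiftμ : ∀ {ρ ρ' c b w} → (∀ α → ρ' (lift c α) ≡ ρ α) → Sim ρ b w →
  Sim ρ' (shiftμ c b) (shiftμ c w)
simApp-shiftμ : ∀ {ρ ρ' c b ys w} → (∀ α → ρ' (lift c α) ≡ ρ α) → SimApp ρ b ys w →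
  SimApp ρ' (shiftμ c b) ys (shiftμ c w)
sim-shiftμ h sim-var       = sim-var
sim-shiftμ h (sim-lam s)   = sim-lam (sim-shiftμ (cong (map suc) ∘ h) s)
sim-shiftμ h (sim-app s t) = sim-app (sim-shiftμ h s) (sim-shiftμ h t)
sim-shiftμ h (sim-mu s)    = sim-mu (sim-shiftμ (bindμ-lift [] h) s)
sim-shiftμ {ρ' = ρ'} h (sim-name {α = α} x) =
  sim-name (subst (λ zs → SimApp ρ' _ zs _) (sym (h α)) (simApp-shiftμ h x))
simApp-shiftμ h (done s)       = done (sim-shiftμ h s)
simApp-shiftμ h (applied eq x) = applied eq (simApp-shiftμ h x)
simApp-shiftμ {ρ' = ρ'} {c} h (absorbed {c = c₀} {y} {ys} x) =
  absorbed (subst (λ z → SimApp ρ' z ys _) (shiftμ-subλ c 0 (var y) c₀) (simApp-shiftμ h x))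
simApp-shiftμ h (pushed {ys = ys} s) = pushed (sim-shiftμ (bindμ-lift ys h) s)

shiftₑ-underλ : ∀ c ρ → mapₑ (lift (suc c)) (underλ ρ) ≗ underλ (mapₑ (lift c) ρ)
shiftₑ-underλ c ρ α = map-square (All.universal (lift-suc c) (ρ α))

sim-shiftλ : ∀ {ρ c b w} → Sim ρ b w → Sim (mapₑ (lift c) ρ) (shiftλ c b) (shiftλ c w)
simApp-shiftλ : ∀ {ρ c b ys w} → SimApp ρ b ys w →
  SimApp (mapₑ (lift c) ρ) (shiftλ c b) (map (lift c) ys) (shiftλ c w)
sim-shiftλ {c = c} (sim-var {n = n}) = subst (λ z → Sim _ z z) (sym (shiftλ-var c n)) sim-var
sim-shiftλ {ρ} {c} (sim-lam s)   = sim-lam (sim-cong (shiftₑ-underλ c ρ) (sim-shiftλ s))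
sim-shiftλ (sim-app s t)         = sim-app (sim-shiftλ s) (sim-shiftλ t)
sim-shiftλ {ρ} {c} (sim-mu s)    = sim-mu (sim-cong (mapₑ-bindμ (lift c) [] ρ) (sim-shiftλ s))
sim-shiftλ (sim-name x)          = sim-name (simApp-shiftλ x)
simApp-shiftλ (done s) = done (sim-shiftλ s)
simApp-shiftλ {ρ} {c} (applied {u = u} {ys} {ys'} {y} {w} eq x) =
  subst (λ z → SimApp (mapₑ (lift c) ρ) (shiftλ c u) (map (lift c) ys') (app (shiftλ c w) z))
        (sym (shiftλ-var c y))
        (applied (trans (cong (map (lift c)) eq) (map-++ (lift c) ys (y ∷ []))) (simApp-shiftλ x))
simApp-shiftλ {ρ} {c} (absorbed {c = c₀} {y} {ys} {w} x) =
  absorbed (subst (λ z → SimApp (mapₑ (lift c) ρ) z (map (lift c) ys) (shiftλ c w)) eq (simApp-shiftλ x))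
  where
  eq : shiftλ c (subλ 0 (var y) c₀) ≡ subλ 0 (var (lift c y)) (shiftλ (suc c) c₀)
  eq = trans (shiftλ-subλ-above z≤n (var y) c₀)
             (cong (λ z → subλ 0 z (shiftλ (suc c) c₀)) (shiftλ-var c y))
simApp-shiftλ {ρ} {c} (pushed {ys = ys} s) =
  pushed (sim-cong (mapₑ-bindμ (lift c) ys ρ) (sim-shiftλ s))

sim-subμ : ∀ {ρ β a wa v wv} → ρ β ≡ [] → Sim ρ v wv → Sim ρ a wa →
  Sim ρ (subμ β v a) (subμ β wv wa)
simApp-subμ : ∀ {ρ β a ys wa v wv} → ρ β ≡ [] → Sim ρ v wv → SimApp ρ a ys wa →
  SimApp ρ (subμ β v a) ys (subμ β wv wa)
sim-subμ e sv sim-var       = sim-var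
sim-subμ e sv (sim-lam s)   = sim-lam (sim-subμ (cong (map suc) e) (sim-shiftλ sv) s)
sim-subμ e sv (sim-app s t) = sim-app (sim-subμ e sv s) (sim-subμ e sv t)
sim-subμ e sv (sim-mu s)    = sim-mu (sim-subμ e (sim-shiftμ (λ α → refl) sv) s)
sim-subμ {ρ} {β} e sv (sim-name {α = α} x) with α ≟ β
... | yes refl rewrite ≡ᵇ-refl α =
  sim-name (subst (λ zs → SimApp ρ _ zs _) (sym e)
    (done (sim-app (sim-subμ e sv (simApp-[] (subst (λ zs → SimApp ρ _ zs _) e x))) sv)))
... | no α≢β rewrite ≡ᵇ-false α≢β = sim-name (simApp-subμ e sv x)
simApp-subμ e sv (done s)       = done (sim-subμ e sv s)
simApp-subμ e sv (applied eq x) = applied eq (simApp-subμ e sv x)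
simApp-subμ {ρ} {β} {v = v} {wv} e sv (absorbed {c = c} {y} {ys} {w} x) =
  absorbed (subst (λ z → SimApp ρ z ys (subμ β wv w)) (sym eq) (simApp-subμ e sv x))
  where
  eq : subλ 0 (var y) (subμ β (shiftλ 0 v) c) ≡ subμ β v (subλ 0 (var y) c)
  eq = trans (rename-subμ 0 y β (shiftλ 0 v) c)
             (cong (λ z → subμ β z (subλ 0 (var y) c)) (subλ-shiftλ 0 (var y) v))
simApp-subμ e sv (pushed s) = pushed (sim-subμ e (sim-shiftμ (λ α → refl) sv) s)

-- λ-substitution for a variable j that occurs in no pending list; the pending
-- variables are renumbered by lower j as the binder j disappears.
Avoids : ℕ → Env → Set
Avoids j ρ = ∀ α → All (_≢ j) (ρ α)

lower : ℕ → ℕ → ℕ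
lower j y = if y <ᵇ j then y else pred y

subλ-other : ∀ {j y} s → y ≢ j → subλ j s (var y) ≡ var (lower j y)
subλ-other {j} {y} s y≢j with <-cmp y j
... | tri< y<j _ _ rewrite <ᵇ-true y<j = refl
... | tri≈ _ y≡j _ = ⊥-elim (y≢j y≡j)
... | tri> _ _ j<y rewrite <ᵇ-false (<⇒≤ j<y) | ≡ᵇ-false y≢j = refl

lower-suc : ∀ {j x} → x ≢ j → suc (lower j x) ≡ lower (suc j) (suc x)
lower-suc {j} {x} x≢j with <-cmp x j
... | tri< x<j _ _ rewrite <ᵇ-true x<j = refl
... | tri≈ _ x≡j _ = ⊥-elim (x≢j x≡j)
... | tri> _ _ j<x rewrite <ᵇ-false (<⇒≤ j<x) = suc-pred-< j<x

avoids-underλ : ∀ {j ρ} → Avoids j ρ → Avoids (suc j) (underλ ρ)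
avoids-underλ av α = map⁺ (All.map (λ x≢j → x≢j ∘ suc-injective) (av α))

avoids-bindμ : ∀ {j ρ ys} → Avoids j ρ → All (_≢ j) ys → Avoids j (bindμ ys ρ)
avoids-bindμ av avys zero    = avys
avoids-bindμ av avys (suc α) = av α

lower-underλ : ∀ {j ρ} → Avoids j ρ → mapₑ (lower (suc j)) (underλ ρ) ≗ underλ (mapₑ (lower j) ρ)
lower-underλ av α = sym (map-square (All.map lower-suc (av α)))

sim-subλ : ∀ {j ρ a wa b wb} → Avoids j ρ → Sim (mapₑ (lower j) ρ) b wb → Sim ρ a wa →
  Sim (mapₑ (lower j) ρ) (subλ j b a) (subλ j wb wa)
simApp-subλ : ∀ {j ρ a ys wa b wb} → Avoids j ρ → All (_≢ j) ys →
  Sim (mapₑ (lower j) ρ) b wb → SimApp ρ a ys wa →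
  SimApp (mapₑ (lower j) ρ) (subλ j b a) (map (lower j) ys) (subλ j wb wa)
sim-subλ {j} {b = b} {wb = wb} av sb (sim-var {n = n}) with <-cmp n j
... | tri< n<j _ _  = subst₂ (Sim _) (sym (subλ-below b n<j)) (sym (subλ-below wb n<j)) sim-var
... | tri≈ _ refl _ = subst₂ (Sim _) (sym (subλ-at n b)) (sym (subλ-at n wb)) sb
... | tri> _ _ j<n  = subst₂ (Sim _) (sym (subλ-above b j<n)) (sym (subλ-above wb j<n)) sim-var
sim-subλ av sb (sim-lam s) =
  sim-lam (sim-cong (lower-underλ av)
    (sim-subλ (avoids-underλ av) (sim-cong (sym ∘ lower-underλ av) (sim-shiftλ sb)) s))
sim-subλ av sb (sim-app s t) = sim-app (sim-subλ av sb s) (sim-subλ av sb t)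
sim-subλ {j} {ρ} av sb (sim-mu s) =
  sim-mu (sim-cong (mapₑ-bindμ (lower j) [] ρ) (sim-subλ (avoids-bindμ av []) (sim-shiftμ (λ α → refl) sb) s))
sim-subλ av sb (sim-name {α = α} x) = sim-name (simApp-subλ av (av α) sb x)
simApp-subλ av avys sb (done s) = done (sim-subλ av sb s)
simApp-subλ {j} {ρ} {b = b} {wb = wb} av avys sb (applied {u = u} {ys} {ys'} {y} {w} eq x)
  with ++⁻ ys (subst (All (_≢ j)) eq avys)
... | avys₀ , (y≢j ∷ []) =
  subst (λ z → SimApp (mapₑ (lower j) ρ) (subλ j b u) (map (lower j) ys') (app (subλ j wb w) z))
        (sym (subλ-other wb y≢j))
        (applied (trans (cong (map (lower j)) eq) (map-++ (lower j) ys (y ∷ [])))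
                 (simApp-subλ av avys₀ sb x))
simApp-subλ {j} {ρ} {b = b} {wb = wb} av (y≢j ∷ avys) sb (absorbed {c = c} {y} {ys} {w} x) =
  absorbed (subst (λ z → SimApp (mapₑ (lower j) ρ) z (map (lower j) ys) (subλ j wb w)) eq
                  (simApp-subλ av avys sb x))
  where
  eq : subλ j b (subλ 0 (var y) c) ≡ subλ 0 (var (lower j y)) (subλ (suc j) (shiftλ 0 b) c)
  eq = trans (subλ-subλ z≤n b (var y) c)
             (cong (λ z → subλ 0 z (subλ (suc j) (shiftλ 0 b) c)) (subλ-other b y≢j))
simApp-subλ {j} {ρ} av avys sb (pushed {ys = ys} s) =
  pushed (sim-cong (mapₑ-bindμ (lower j) ys ρ) (sim-subλ (avoids-bindμ av avys) (sim-shiftμ (λ α → refl) sb) s))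

sim-β : ∀ {ρ c wc b wb} → Sim (underλ ρ) c wc → Sim ρ b wb → Sim ρ (subλ 0 b c) (subλ 0 wb wc)
sim-β {ρ} s sb = sim-cong lower-0 (sim-subλ avoids-0 (sim-cong (sym ∘ lower-0) sb) s)
  where
  lower-0 : mapₑ (lower 0) (underλ ρ) ≗ ρ
  lower-0 α = trans (sym (map-∘ (ρ α))) (map-id (ρ α))
  avoids-0 : Avoids 0 (underλ ρ)
  avoids-0 α = map⁺ (All.universal (λ _ ()) (ρ α))

-- Contracting the redex formed by the last supplied argument y: a λ absorbs it …
contract-λ : ∀ {ρ u ys ys' y wc} → SimApp ρ u ys (lam wc) → ys' ≡ ys ++ y ∷ [] →
  SimApp ρ u ys' (subλ 0 (var y) wc)
contract-λ (done (sim-lam s)) refl = absorbed (done (sim-β s sim-var))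
contract-λ (absorbed x)         refl = absorbed (contract-λ x refl)

-- … and a μ receives it as a structural substitution.
contract-μ : ∀ {ρ u ys ys' y wc} → SimApp ρ u ys (mu wc) → ys' ≡ ys ++ y ∷ [] →
  SimApp ρ u ys' (mu (subμ 0 (var y) wc))
contract-μ (done (sim-mu s)) eq = pushed (sim-subμ-var (appended-head eq) s)
contract-μ (absorbed x)   refl = absorbed (contract-μ x refl)
contract-μ (pushed s)     eq   = pushed (sim-subμ-var (appended-head eq) s)

Matched : (Term → Set) → Term → Set
Matched P u = P u ⊎ Σ Term λ u' → u ▷ u' × P u'

matched-map : ∀ {P Q : Term → Set} {u} (f : Term → Term) → (∀ {a b} → a ▷ b → f a ▷ f b) →
  (∀ {a} → P a → Q (f a)) → Matched P u → Matched Q (f u)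
matched-map f ξ g (inj₁ p)            = inj₁ (g p)
matched-map f ξ g (inj₂ (u' , s , p)) = inj₂ (f u' , ξ s , g p)

sim-step : ∀ {ρ u w w'} → Sim ρ u w → w ▷ w' → Matched (λ u → Sim ρ u w') u
simApp-step : ∀ {ρ u ys w w'} → SimApp ρ u ys w → w ▷ w' → Matched (λ u → SimApp ρ u ys w') u
sim-step (sim-lam s)   (ξlam q)  = matched-map lam ξlam sim-lam (sim-step s q)
sim-step (sim-app s t) (ξappl q) = matched-map (λ a → app a _) ξappl (λ s' → sim-app s' t) (sim-step s q)
sim-step (sim-app s t) (ξappr q) = matched-map (app _) ξappr (sim-app s) (sim-step t q)
sim-step (sim-app (sim-lam s) t) βλ = inj₂ (_ , βλ , sim-β s t)
sim-step (sim-app (sim-mu s) t)  βμ = inj₂ (_ , βμ , sim-mu (sim-subμ refl (sim-shiftμ (λ α → refl) t) s))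
sim-step (sim-mu s)    (ξmu q)   = matched-map mu ξmu sim-mu (sim-step s q)
sim-step (sim-name x)  (ξname q) = matched-map (name _) ξname sim-name (simApp-step x q)
simApp-step (done s)       q         = matched-map id id done (sim-step s q)
simApp-step (applied eq x) (ξappl q) = matched-map id id (applied eq) (simApp-step x q)
simApp-step (applied eq x) βλ        = inj₁ (contract-λ x eq)
simApp-step (applied eq x) βμ        = inj₁ (contract-μ x eq)
simApp-step (absorbed {c = c} {y} x) q with simApp-step x q
... | inj₁ x' = inj₁ (absorbed x')
... | inj₂ (d , s , x') with unrename-step 0 y c s
...   | c' , s' , refl = inj₂ (lam c' , ξlam s' , absorbed x')
simApp-step (pushed s) (ξmu q) = matched-map mu ξmu pushed (sim-step s q)

simApp-normalizable : ∀ {ρ u ys w N} → SimApp ρ u ys w → w ▷* N → Normal N → Normalizable u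
simApp-normalizable x refl* N-normal =
  _ , refl* , NF⇒Normal (NF-reflectApp x (Normal⇒NF _ N-normal))
simApp-normalizable x (step* s w'▷*N) N-normal with simApp-step x s
... | inj₁ x' = simApp-normalizable x' w'▷*N N-normal
... | inj₂ (u' , s' , x') with simApp-normalizable x' w'▷*N N-normal
...   | n , u'▷*n , n-normal = n , step* s' u'▷*n , n-normal

sim-refl : ∀ {ρ} → (∀ α → ρ α ≡ []) → ∀ t → Sim ρ t t
sim-refl none (var n)    = sim-var
sim-refl none (lam t)    = sim-lam (sim-refl (cong (map suc) ∘ none) t)
sim-refl none (app a b)  = sim-app (sim-refl none a) (sim-refl none b)
sim-refl none (mu t)     = sim-mu (sim-refl (λ { zero → refl ; (suc α) → none α }) t)
sim-refl {ρ} none (name α t) = sim-name (subst (λ zs → SimApp ρ t zs t) (sym (none α)) (done (sim-refl none t)))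

-- (t y) simulates t applied to the single argument y.
lemma3p1 : (t : Term) (y : ℕ) → Normalizable (app t (var y)) → Normalizable t
lemma3p1 t y (N , t·y▷*N , N-normal) =
  simApp-normalizable {ρ = λ _ → []} (applied {ys = []} refl (done (sim-refl (λ _ → refl) t))) t·y▷*N N-normal
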